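{- Let $n>1$ be an integer and $k$ a positive integer. Then $(1,n^{(n+1)k}-1,n^{(n+1)k})$ is an $abc$ triple whenever $(n+1)k$ is even.
   Context: For a positive integer $n$, $\operatorname{rad}(n)$ denotes the product of the distinct prime factors of $n$. An $abc$ triple is a triple $(a,b,c)$ of relatively prime positive integers with $a+b=c$ and $\operatorname{rad}(abc)<c$. -}

module Defs where

open import Data.Nat using (ℕ; _+_; _*_; _<_; suc)
open import Data.Nat.Divisibility using (_∣_; _∣?_)
open import Data.Nat.Primality using (Prime; prime?)
open import Data.Nat.Coprimality using (Coprime)
open import Data.List using (List; filter; upTo)
open import Data.Nat.ListAction using (product)
open import Data.Product using (_×_)
open import Relation.Binary.PropositionalEquality using (_≡_)
open import Relation.Nullary.Decidable using (_×-dec_)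

-- rad n : product of the distinct primes p dividing n
-- (primes dividing a positive n are ≤ n, so we range over p ∈ {0, …, n}).
-- Convention: rad 0 = 1 (irrelevant here: rad is only applied to positive numbers).
rad : ℕ → ℕ
rad n = product (filter (λ p → prime? p ×-dec (p ∣? n)) (upTo (suc n)))

record IsABCTriple (a b c : ℕ) : Set where
  field
    a-pos  : 0 < a
    b-pos  : 0 < b
    c-pos  : 0 < c
    cop-ab : Coprime a b
    cop-ac : Coprime a c
    cop-bc : Coprime b c
    sum    : a + b ≡ c
    radLt  : rad (a * b * c) < c

-- Put N = n ^ m with m = (n + 1) k even. Since n² = 1 + (n − 1)(n + 1), the binomial
-- theorem gives N ≡ 1 + (m / 2)(n − 1)(n + 1) modulo (n + 1)², and the parity hypothesis
-- makes n + 1 divide (m / 2)(n − 1); so N − 1 = (n + 1)² q. Every prime factor of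
-- (N − 1) N divides q (n + 1) n, hence rad((N − 1) N) ≤ q (n + 1) n < q (n + 1)² = N − 1.
module Submission where

open import Defs
open import Data.Nat using (ℕ; _+_; _*_; _∸_; _^_; _<_)
open import Data.Nat.Divisibility using (_∣_)

open import Data.Nat using (suc; NonZero; _≤_; s≤s; z<s; s<s⁻¹; >-nonZero; >-nonZero⁻¹)
open import Data.Nat.Properties
open import Data.Nat.Divisibility
  using (_∣?_; divides; ∣1⇒≡1; ∣m+n∣m⇒∣n; m∣m*n; ∣m⇒∣m*n; ∣n⇒∣m*n; ∣⇒≤)
open import Data.Nat.Primality using (Prime; prime?; euclidsLemma; prime⇒irreducible; ¬prime[1])
open import Data.Nat.Coprimality using (Coprime; coprime-divisor)
open import Data.Nat.ListAction using (product)
open import Data.List using ([]; _∷_; upTo)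
open import Data.List.Relation.Unary.All as All using (All; []; _∷_)
open import Data.List.Relation.Unary.All.Properties using (all-filter)
open import Data.List.Relation.Unary.AllPairs using ([]; _∷_)
open import Data.List.Relation.Unary.Unique.Propositional using (Unique)
import Data.List.Relation.Unary.Unique.Propositional.Properties as Unique
open import Data.Product using (∃-syntax; _,_; proj₁; proj₂)
open import Data.Sum using (inj₁; inj₂; reduce)
open import Data.Empty using (⊥-elim)
open import Relation.Nullary using (¬_)
open import Relation.Nullary.Decidable using (_×-dec_)
open import Relation.Binary.PropositionalEquality
open import Data.Nat.Tactic.RingSolver using (solve-∀)

prime∤⇒coprime : ∀ {p m} → Prime p → ¬ p ∣ m → Coprime p m
prime∤⇒coprime p-prime p∤m (d∣p , d∣m) with prime⇒irreducible p-prime d∣p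
... | inj₁ d≡1 = d≡1
... | inj₂ refl = ⊥-elim (p∤m d∣m)

prime∣prime⇒≡ : ∀ {p q} → Prime p → Prime q → p ∣ q → p ≡ q
prime∣prime⇒≡ p-prime q-prime p∣q with prime⇒irreducible q-prime p∣q
... | inj₁ refl = ⊥-elim (¬prime[1] p-prime)
... | inj₂ p≡q = p≡q

prime∤product : ∀ {p} qs → Prime p → All Prime qs → All (λ q → ¬ p ≡ q) qs →
  ¬ p ∣ product qs
prime∤product []       p-prime _ _ p∣1 = ¬prime[1] (subst Prime (∣1⇒≡1 p∣1) p-prime)
prime∤product (q ∷ qs) p-prime (q-prime ∷ qs-prime) (p≢q ∷ p∉qs) p∣q*qs
  with euclidsLemma q (product qs) p-prime p∣q*qs
... | inj₁ p∣q  = p≢q (prime∣prime⇒≡ p-prime q-prime p∣q)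
... | inj₂ p∣qs = prime∤product qs p-prime qs-prime p∉qs p∣qs

coprime⇒*∣ : ∀ {m n o} → Coprime m n → m ∣ o → n ∣ o → m * n ∣ o
coprime⇒*∣ {m} {n} m⊥n m∣o (divides t o≡t*n)
  with coprime-divisor m⊥n (subst (m ∣_) (trans o≡t*n (*-comm t n)) m∣o)
... | divides u t≡u*m = divides u (begin
  _         ≡⟨ o≡t*n ⟩
  t * n     ≡⟨ cong (_* n) t≡u*m ⟩
  u * m * n ≡⟨ *-assoc u m n ⟩
  u * (m * n) ∎)
  where open ≡-Reasoning

product-primes∣ : ∀ {n} ps → Unique ps → All Prime ps → All (_∣ n) ps → product ps ∣ n
product-primes∣ {n} [] _ _ _ = divides n (sym (*-identityʳ n))
product-primes∣ (p ∷ ps) (p∉ps ∷ ps-unique) (p-prime ∷ ps-prime) (p∣n ∷ ps∣n) =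
  coprime⇒*∣ (prime∤⇒coprime p-prime (prime∤product ps p-prime ps-prime p∉ps))
    p∣n (product-primes∣ ps ps-unique ps-prime ps∣n)

rad∣ : ∀ {m n} → (∀ p → Prime p → p ∣ m → p ∣ n) → rad m ∣ n
rad∣ {m} primes∣n = product-primes∣ _ (Unique.filter⁺ primeFactor? (Unique.upTo⁺ (suc m)))
  (All.map proj₁ factors) (All.map (λ (p-prime , p∣m) → primes∣n _ p-prime p∣m) factors)
  where
  primeFactor? = λ p → prime? p ×-dec (p ∣? m)
  factors = all-filter primeFactor? (upTo (suc m))

prime∣m^n⇒∣m : ∀ {p} m n → Prime p → p ∣ m ^ n → p ∣ m
prime∣m^n⇒∣m m 0       p-prime p∣1 = ⊥-elim (¬prime[1] (subst Prime (∣1⇒≡1 p∣1) p-prime))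
prime∣m^n⇒∣m m (suc n) p-prime p∣m*m^n with euclidsLemma m (m ^ n) p-prime p∣m*m^n
... | inj₁ p∣m   = p∣m
... | inj₂ p∣m^n = prime∣m^n⇒∣m m n p-prime p∣m^n

[1+x]^j≡1+j*x+x*x*s : ∀ x j → ∃[ s ] (1 + x) ^ j ≡ 1 + j * x + x * x * s
[1+x]^j≡1+j*x+x*x*s x 0 = 0 , cong suc (sym (*-zeroʳ (x * x)))
[1+x]^j≡1+j*x+x*x*s x (suc j) with [1+x]^j≡1+j*x+x*x*s x j
... | s , eq = s + j + x * s , trans (cong ((1 + x) *_) eq) (expand x j s)
  where
  expand : ∀ x j s → (1 + x) * (1 + j * x + x * x * s) ≡
    1 + (1 + j) * x + x * x * (s + j + x * s)
  expand = solve-∀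

2∣[t+2]*k⇒2∣t*k : ∀ t k → 2 ∣ (suc t + 1) * k → 2 ∣ t * k
2∣[t+2]*k⇒2∣t*k t k 2∣[t+2]*k = ∣m+n∣m⇒∣n (subst (2 ∣_) (split t k) 2∣[t+2]*k) (m∣m*n k)
  where
  split : ∀ t k → (suc t + 1) * k ≡ 2 * k + t * k
  split = solve-∀

n^[n+1]*k≡1+[n+1]²*q : ∀ n .{{_ : NonZero n}} k → 2 ∣ (n + 1) * k →
  ∃[ q ] n ^ ((n + 1) * k) ≡ 1 + (n + 1) * (n + 1) * q
n^[n+1]*k≡1+[n+1]²*q (suc t) k 2∣m with 2∣[t+2]*k⇒2∣t*k t k 2∣m
... | divides r t*k≡r*2 with [1+x]^j≡1+j*x+x*x*s (t * (suc t + 1)) (r + k)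
...   | s , binomial = r + t * t * s , (begin
  n ^ (a * k)                            ≡⟨ cong (n ^_) m≡2*j ⟩
  n ^ (2 * j)                            ≡⟨ ^-*-assoc n 2 j ⟨
  (n ^ 2) ^ j                            ≡⟨ cong (_^ j) (square t) ⟩
  (1 + t * a) ^ j                        ≡⟨ binomial ⟩
  1 + j * (t * a) + t * a * (t * a) * s  ≡⟨ regroup j t a s ⟩
  1 + j * t * a + a * a * (t * t * s)    ≡⟨ cong (λ z → 1 + z * a + a * a * (t * t * s)) j*t≡r*a ⟩
  1 + r * a * a + a * a * (t * t * s)    ≡⟨ factor r a (t * t * s) ⟩
  1 + a * a * (r + t * t * s)            ∎)
  where
  open ≡-Reasoning
  n = suc t
  a = suc t + 1
  j = r + k
  square : ∀ t → suc t * (suc t * 1) ≡ 1 + t * (suc t + 1)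
  square = solve-∀
  regroup : ∀ j t a s → 1 + j * (t * a) + t * a * (t * a) * s ≡ 1 + j * t * a + a * a * (t * t * s)
  regroup = solve-∀
  factor : ∀ r a u → 1 + r * a * a + a * a * u ≡ 1 + a * a * (r + u)
  factor = solve-∀
  m≡2*j : a * k ≡ 2 * j
  m≡2*j = begin
    a * k         ≡⟨ split t k ⟩
    t * k + 2 * k ≡⟨ cong (_+ 2 * k) t*k≡r*2 ⟩
    r * 2 + 2 * k ≡⟨ double r k ⟩
    2 * (r + k)   ∎
    where
    split : ∀ t k → (suc t + 1) * k ≡ t * k + 2 * k
    split = solve-∀
    double : ∀ r k → r * 2 + 2 * k ≡ 2 * (r + k)
    double = solve-∀
  j*t≡r*a : j * t ≡ r * a
  j*t≡r*a = begin
    (r + k) * t   ≡⟨ distrib r k t ⟩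
    r * t + t * k ≡⟨ cong (r * t +_) t*k≡r*2 ⟩
    r * t + r * 2 ≡⟨ collect r t ⟩
    r * a         ∎
    where
    distrib : ∀ r k t → (r + k) * t ≡ r * t + t * k
    distrib = solve-∀
    collect : ∀ r t → r * t + r * 2 ≡ r * (suc t + 1)
    collect = solve-∀

isABCTriple[1,a*a*q] : ∀ {n a q} → 0 < n → n < a → 0 < q →
  (∀ p → Prime p → p ∣ suc (a * a * q) → p ∣ n) →
  IsABCTriple 1 (a * a * q) (suc (a * a * q))
isABCTriple[1,a*a*q] {n} {a} {q} n>0 n<a q>0 primes∣n = record
  { a-pos  = z<s
  ; b-pos  = <-≤-trans aqn>0 aqn≤b
  ; c-pos  = z<s
  ; cop-ab = λ (d∣1 , _) → ∣1⇒≡1 d∣1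
  ; cop-ac = λ (d∣1 , _) → ∣1⇒≡1 d∣1
  ; cop-bc = λ {d} (d∣b , d∣1+b) → ∣1⇒≡1 (∣m+n∣m⇒∣n (subst (d ∣_) (+-comm 1 b) d∣1+b) d∣b)
  ; sum    = refl
  ; radLt  = s≤s (≤-trans (∣⇒≤ {{>-nonZero aqn>0}} (rad∣ primes∣aqn)) aqn≤b)
  }
  where
  b = a * a * q
  aqn>0 : 0 < a * q * n
  aqn>0 = *-mono-≤ (*-mono-≤ (<-≤-trans n>0 (<⇒≤ n<a)) q>0) n>0
  aqn≤b : a * q * n ≤ b
  aqn≤b = ≤-trans (*-monoʳ-≤ (a * q) (<⇒≤ n<a)) (≤-reflexive (swap a q))
    where
    swap : ∀ a q → a * q * a ≡ a * a * q
    swap = solve-∀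
  primes∣aqn : ∀ p → Prime p → p ∣ 1 * b * suc b → p ∣ a * q * n
  primes∣aqn p p-prime p∣abc with euclidsLemma (1 * b) (suc b) p-prime p∣abc
  ... | inj₂ p∣c = ∣n⇒∣m*n (a * q) (primes∣n p p-prime p∣c)
  ... | inj₁ p∣1*b with euclidsLemma (a * a) q p-prime (subst (p ∣_) (*-identityˡ b) p∣1*b)
  ...   | inj₁ p∣a*a = ∣m⇒∣m*n n (∣m⇒∣m*n q (reduce (euclidsLemma a a p-prime p∣a*a)))
  ...   | inj₂ p∣q   = ∣m⇒∣m*n n (∣n⇒∣m*n a p∣q)

corollary3p8 : (n k : ℕ) → 1 < n → 0 < k → 2 ∣ (n + 1) * k →
    IsABCTriple 1 (n ^ ((n + 1) * k) ∸ 1) (n ^ ((n + 1) * k))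
corollary3p8 n@(suc _) k n>1 k>0 2∣m = subst (λ c → IsABCTriple 1 (c ∸ 1) c) (sym n^m≡1+a²q)
  (isABCTriple[1,a*a*q] z<s (m<m+n n z<s) q>0 primes∣n)
  where
  a = n + 1
  q = proj₁ (n^[n+1]*k≡1+[n+1]²*q n k 2∣m)
  n^m≡1+a²q : n ^ (a * k) ≡ 1 + a * a * q
  n^m≡1+a²q = proj₂ (n^[n+1]*k≡1+[n+1]²*q n k 2∣m)
  1<n^m : 1 < n ^ (a * k)
  1<n^m = ^-monoʳ-< n n>1 (*-mono-≤ {1} {a} z<s k>0)
  q>0 : 0 < q
  q>0 = >-nonZero⁻¹ q {{m*n≢0⇒n≢0 (a * a) {{>-nonZero (s<s⁻¹ (subst (1 <_) n^m≡1+a²q 1<n^m))}}}}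
  primes∣n : ∀ p → Prime p → p ∣ suc (a * a * q) → p ∣ n
  primes∣n p p-prime p∣c = prime∣m^n⇒∣m n (a * k) p-prime (subst (p ∣_) (sym n^m≡1+a²q) p∣c)
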